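{- Let $m,t,d$ be positive integers such that $2^m\geq (2^{d+1}m)^t$, and let $\lambda$ be a map assigning an element of $\{ -,+\}^d$ to each non-leaf vertex of $BT_m$. Then there exists a set $S\subset[2^m]$ of leaves with $|S|=2^t$ that is perfect with respect to $(BT_m,\lambda)$.
   Context: A rooted tree is a tree with a distinguished root; the depth of a vertex is its distance to the root; $w$ is an ancestor of $v$ (and $v$ a descendant of $w$) if $w$ lies on the path from $v$ to the root (every vertex is its own ancestor and descendant); $v,w$ are related if one is an ancestor of the other. For a vertex set $S$, $\delta(S)$ is the common ancestor of all elements of $S$ of largest depth, and $\delta(x,y)=\delta(\{x,y\})$. For nonempty $X\subset V(T)$, the induced subtree $T[X]$ is the rooted tree with vertex set $\{\delta(v,w):v,w\in X\}$, root $\delta(X)$, in which distinct $x,y$ are adjacent iff one is an ancestor of the other in $T$ and no other vertex of $T[X]$ is a descendant of one and an ancestor of the other. $BT_m$ is the perfect rooted binary tree of height $m$ ($BT_0$ a single vertex; $BT_m$ obtained by attaching two children to each leaf of $BT_{m-1}$), with leaves identified with $1,\dots,2^m$ from left to right (children of leaf $i$ of $BT_{m-1}$ become $2i-1,2i$). A set $S\subset[2^m]$ is perfect with respect to $(BT_m,\lambda)$ if $BT_m[S]$ is a perfect rooted binary tree (i.e. isomorphic as a rooted tree to $BT_k$ for some $k$) and the label $\lambda(v)$ of each non-leaf vertex $v$ of $BT_m[S]$ depends only on the depth of $v$ in $BT_m[S]$. -}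

module Defs where

open import Data.Nat using (ℕ; _≤_; _<_; _^_; _*_; _+_; suc)
open import Data.Bool using (Bool)
open import Data.List using (List; []; _∷_; _++_; [_]; length)
open import Data.List.Membership.Propositional using (_∈_)
open import Data.Vec using (Vec)
open import Data.Product using (Σ; ∃; _×_; _,_; proj₁)
open import Data.Sum using (_⊎_)
open import Relation.Binary.PropositionalEquality using (_≡_; _≢_)
open import Relation.Nullary using (¬_)
open import Function.Bundles using (_⇔_)

data Sign : Set where
  minus plus : Sign

-- Vertices of a perfect rooted binary tree are encoded by their path from the
-- root: a list of bits (false = left child, true = right child).  The root is
-- [], the children of u are u ++ [ false ] and u ++ [ true ], the depth of u is
-- length u.  Vertices of BT_m are the bit lists of length ≤ m; its leaves are
-- the bit lists of length m (leaf i ∈ [2^m] ↔ the binary expansion of i-1,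
-- read left to right).

Anc : List Bool → List Bool → Set
Anc w v = ∃ λ r → w ++ r ≡ v

IsDelta : List (List Bool) → List Bool → Set
IsDelta X r =
  (∀ {x} → x ∈ X → Anc r x) ×
  (∀ r' → (∀ {x} → x ∈ X → Anc r' x) → length r' ≤ length r)

-- u is a vertex of the induced subtree T[X]: u = δ(v,w) for some v,w ∈ X.
InInd : List (List Bool) → List Bool → Set
InInd X u = ∃ λ v → ∃ λ w → v ∈ X × w ∈ X × IsDelta (v ∷ w ∷ []) u

AdjInd : List (List Bool) → List Bool → List Bool → Set
AdjInd X x y =
  InInd X x × InInd X y × x ≢ y × (Anc x y ⊎ Anc y x) ×
  (∀ z → InInd X z → z ≢ x → z ≢ y →
     ¬ ((Anc x z × Anc z y) ⊎ (Anc y z × Anc z x)))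

BTVert : ℕ → Set
BTVert k = Σ (List Bool) (λ u → length u ≤ k)

AdjBT : List Bool → List Bool → Set
AdjBT u v = (∃ λ b → v ≡ u ++ [ b ]) ⊎ (∃ λ b → u ≡ v ++ [ b ])

IsRootedIso : (X : List (List Bool)) (k : ℕ) → (BTVert k → List Bool) → Set
IsRootedIso X k f =
  (∀ a → InInd X (f a)) ×
  (∀ a b → f a ≡ f b → proj₁ a ≡ proj₁ b) ×
  (∀ y → InInd X y → ∃ λ a → f a ≡ y) ×
  (∀ a b → AdjBT (proj₁ a) (proj₁ b) ⇔ AdjInd X (f a) (f b)) ×
  IsDelta X (f ([] , Data.Nat.z≤n))

Labelling : ℕ → ℕ → Set
Labelling m d = (u : List Bool) → length u < m → Vec Sign d

-- S is perfect w.r.t. (BT_m, λ): BT_m[S] ≅ BT_k (as rooted trees) via some f,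
-- and the label of each non-leaf vertex of BT_m[S] depends only on its depth
-- in BT_m[S] (= the depth of its preimage in BT_k).
Perfect : (m d : ℕ) → Labelling m d → List (List Bool) → Set
Perfect m d lab S =
  ∃ λ k → ∃ λ (f : BTVert k → List Bool) → IsRootedIso S k f ×
    (∀ a b → length (proj₁ a) ≡ length (proj₁ b) → length (proj₁ a) < k →
       (pa : length (f a) < m) (pb : length (f b) < m) →
       lab (f a) pa ≡ lab (f b) pb)

{-# OPTIONS --safe #-}
module Submission where

-- Let K = 2^(d+1) m. For j = 0, …, t we find vertices R_j of BT_m, all of one depth, each the root
-- of a copy of BT_j whose vertices at each level share a label, with |R_j| K^j ≥ 2^m; R_0 is the
-- set of leaves. A binary tree with k leaves has k - 1 branching vertices, so at least |R_j| - 1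
-- vertices have elements of R_j below both children; each of them roots a copy of BT_(j+1).
-- Sorting them by depth and label into m 2^d classes, the largest class R_(j+1) has at least
-- (|R_j| - 1) / (m 2^d) ≥ |R_j| / K elements. As K^t ≤ 2^m, R_t is nonempty, and the leaves of
-- any of its copies of BT_t form the required set.

open import Defs
open import Data.Nat
  using (ℕ; zero; suc; _≤_; _<_; _^_; _*_; _+_; z≤n; s≤s; _≤?_; _<?_; NonZero; >-nonZero)
open import Data.Nat.Tactic.RingSolver using (solve-∀)
open import Data.Nat.Properties
open import Data.Fin using (fromℕ<)
open import Data.Fin.Properties using (fromℕ<-cong)
open import Data.Bool using (Bool; true; false)
import Data.Bool.Properties as Bool
open import Data.List
  using (List; []; _∷_; _++_; [_]; _∷ʳ_; length; map; filter; upTo; cartesianProductWith; cartesianProduct)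
open import Data.List.Properties
  using (length-++; length-map; length-upTo; ++-assoc; ++-identityʳ; ∷ʳ-injectiveʳ
        ; filter-++; filter-accept; filter-reject; filter-all)
open import Data.List.Membership.Propositional using (_∈_)
open import Data.List.Membership.Propositional.Properties
  using (∈-++⁺ˡ; ∈-++⁺ʳ; ∈-++⁻; ∈-filter⁻; ∈-map⁻; ∈-upTo⁺; ∈-upTo⁻
        ; ∈-cartesianProductWith⁺; ∈-cartesianProduct⁺; ∈-cartesianProduct⁻)
open import Data.List.Relation.Unary.Any using (here; there)
open import Data.List.Relation.Unary.All as All using (All; []; _∷_)
import Data.List.Relation.Unary.All.Properties as All
import Data.List.Relation.Unary.AllPairs as AllPairs
open import Data.List.Relation.Unary.Unique.Propositional using (Unique)
import Data.List.Relation.Unary.Unique.Propositional.Properties as Unique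
open import Data.Vec using (Vec; replicate; toList) renaming ([] to []ᵥ; _∷_ to _∷ᵥ_)
import Data.Vec as Vec
import Data.Vec.Properties as Vec
open import Data.Product using (∃; _×_; _,_; proj₁; proj₂)
import Data.Product.Properties as Product
open import Data.Sum using (_⊎_; inj₁; inj₂; [_,_]′; swap)
open import Data.Empty using (⊥; ⊥-elim)
open import Function using (_∘_; case_of_)
open import Function.Bundles using (_⇔_; mk⇔)
open import Relation.Binary.Definitions using (DecidableEquality)
open import Relation.Binary.PropositionalEquality hiding ([_])
open import Relation.Nullary using (¬_; Dec; yes; no)
open import Relation.Nullary.Decidable using (map′; _×-dec_)

module Prefix where

  anc-refl : ∀ v → Anc v v
  anc-refl v = [] , ++-identityʳ v

  anc-trans : ∀ {u v w} → Anc u v → Anc v w → Anc u w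
  anc-trans {u} (r , refl) (s , refl) = r ++ s , sym (++-assoc u r s)

  anc-length : ∀ {u v} → Anc u v → length u ≤ length v
  anc-length {u} (r , refl) = subst (length u ≤_) (sym (length-++ u)) (m≤m+n _ _)

  []-anc : ∀ v → Anc [] v
  []-anc v = v , refl

  ∷-anc⁺ : ∀ {x u v} → Anc u v → Anc (x ∷ u) (x ∷ v)
  ∷-anc⁺ (r , refl) = r , refl

  ∷-anc⁻ : ∀ {x y u v} → Anc (x ∷ u) (y ∷ v) → x ≡ y × Anc u v
  ∷-anc⁻ (r , refl) = refl , (r , refl)

  anc? : (u v : List Bool) → Dec (Anc u v)
  anc? [] v = yes ([]-anc v)
  anc? (x ∷ u) [] = no λ ()
  anc? (x ∷ u) (y ∷ v) with x Bool.≟ y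
  ... | yes refl = map′ ∷-anc⁺ (proj₂ ∘ ∷-anc⁻) (anc? u v)
  ... | no x≢y = no (x≢y ∘ proj₁ ∘ ∷-anc⁻)

  length-<-++-∷ : ∀ (u : List Bool) x r → length u < length (u ++ x ∷ r)
  length-<-++-∷ u x r = subst (length u <_) (sym (length-++ u)) (m<m+n (length u) (s≤s z≤n))

  anc-antisym : ∀ {u v} → Anc u v → length v ≤ length u → u ≡ v
  anc-antisym {u} ([] , refl) _ = sym (++-identityʳ u)
  anc-antisym {u} (x ∷ r , refl) v≤u = ⊥-elim (<⇒≱ (length-<-++-∷ u x r) v≤u)

  anc-connex : ∀ {u v w} → Anc u w → Anc v w → length u ≤ length v → Anc u v
  anc-connex {[]} {v} _ _ _ = []-anc v
  anc-connex {x ∷ u} {[]} _ _ ()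
  anc-connex {x ∷ u} {y ∷ v} {[]} (r , ()) _ _
  anc-connex {x ∷ u} {y ∷ v} {z ∷ w} p q (s≤s u≤v) with ∷-anc⁻ p | ∷-anc⁻ q
  ... | refl , p′ | refl , q′ = ∷-anc⁺ (anc-connex p′ q′ u≤v)

  length-∷ʳ : ∀ (u : List Bool) b → length (u ∷ʳ b) ≡ suc (length u)
  length-∷ʳ u b = trans (length-++ u) (+-comm (length u) 1)

  length-∷ʳ-+ : ∀ (u : List Bool) b h → length (u ∷ʳ b) + h ≡ length u + suc h
  length-∷ʳ-+ u b h = trans (cong (_+ h) (length-∷ʳ u b)) (sym (+-suc (length u) h))

  anc-∷ʳ : ∀ u b → Anc u (u ∷ʳ b)
  anc-∷ʳ u b = [ b ] , refl

  ∷ʳ-anc-length : ∀ {u b v} → Anc (u ∷ʳ b) v → length u < length v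
  ∷ʳ-anc-length {u} {b} p = subst (_≤ _) (length-∷ʳ u b) (anc-length p)

  ∷ʳ-¬anc : ∀ {u b} → ¬ Anc (u ∷ʳ b) u
  ∷ʳ-¬anc p = <-irrefl refl (∷ʳ-anc-length p)

  children-disjoint : ∀ {u v} → Anc (u ∷ʳ false) v → Anc (u ∷ʳ true) v → ⊥
  children-disjoint {u} p q =
    false≢true (∷ʳ-injectiveʳ u u
      (anc-antisym (anc-connex p q (≤-reflexive same-depth)) (≤-reflexive (sym same-depth))))
    where
    false≢true : false ≢ true
    false≢true ()
    same-depth : length (u ∷ʳ false) ≡ length (u ∷ʳ true)
    same-depth = trans (length-∷ʳ u false) (sym (length-∷ʳ u true))

  between-child : ∀ {u v b} → Anc u v → Anc v (u ∷ʳ b) → v ≡ u ⊎ v ≡ u ∷ʳ b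
  between-child {u} {v} {b} p q with length v ≤? length u
  ... | yes v≤u = inj₁ (sym (anc-antisym p v≤u))
  ... | no v≰u = inj₂ (anc-antisym q (subst (_≤ length v) (sym (length-∷ʳ u b)) (≰⇒> v≰u)))

  anc-child : ∀ {u v} → length u < length v → Anc u v → Anc (u ∷ʳ false) v ⊎ Anc (u ∷ʳ true) v
  anc-child {u} u<v ([] , refl) = ⊥-elim (<-irrefl (cong length (sym (++-identityʳ u))) u<v)
  anc-child {u} u<v (false ∷ r , refl) = inj₁ (r , ++-assoc u [ false ] r)
  anc-child {u} u<v (true ∷ r , refl) = inj₂ (r , ++-assoc u [ true ] r)

  anc-proper : ∀ {u v : List Bool} x r → u ++ x ∷ r ≡ v → u ≢ v
  anc-proper {u} x r eq refl = <-irrefl (cong length (sym eq)) (length-<-++-∷ u x r)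

module Enumeration where

  length-cartesianProductWith : ∀ {A B C : Set} (f : A → B → C) xs ys →
    length (cartesianProductWith f xs ys) ≡ length xs * length ys
  length-cartesianProductWith f [] ys = refl
  length-cartesianProductWith f (x ∷ xs) ys = begin
    length (map (f x) ys ++ cartesianProductWith f xs ys) ≡⟨ length-++ (map (f x) ys) ⟩
    length (map (f x) ys) + length (cartesianProductWith f xs ys)
      ≡⟨ cong₂ _+_ (length-map (f x) ys) (length-cartesianProductWith f xs ys) ⟩
    length ys + length xs * length ys ∎
    where open ≡-Reasoning

  vectors : {A : Set} → List A → (n : ℕ) → List (Vec A n)
  vectors as zero = [ []ᵥ ]
  vectors as (suc n) = cartesianProductWith _∷ᵥ_ as (vectors as n)

  length-vectors : ∀ {A : Set} (as : List A) n → length (vectors as n) ≡ length as ^ n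
  length-vectors as zero = refl
  length-vectors as (suc n) =
    trans (length-cartesianProductWith _∷ᵥ_ as (vectors as n)) (cong (length as *_) (length-vectors as n))

  ∈-vectors : ∀ {A : Set} {as : List A} → (∀ a → a ∈ as) → ∀ {n} (v : Vec A n) → v ∈ vectors as n
  ∈-vectors all∈ []ᵥ = here refl
  ∈-vectors all∈ (a ∷ᵥ v) = ∈-cartesianProductWith⁺ _∷ᵥ_ (all∈ a) (∈-vectors all∈ v)

  vectors-unique : ∀ {A : Set} {as : List A} → Unique as → ∀ n → Unique (vectors as n)
  vectors-unique as! zero = [] AllPairs.∷ AllPairs.[]
  vectors-unique as! (suc n) = Unique.cartesianProductWith⁺ _∷ᵥ_ Vec.∷-injective as! (vectors-unique as! n)

  bits : List Bool
  bits = false ∷ true ∷ []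

  bits-unique : Unique bits
  bits-unique = ((λ ()) ∷ []) AllPairs.∷ [] AllPairs.∷ AllPairs.[]

  bitStrings : ℕ → List (List Bool)
  bitStrings n = map toList (vectors bits n)

  bitStrings-length : ∀ n → All (λ u → length u ≡ n) (bitStrings n)
  bitStrings-length n =
    All.tabulate λ u∈ → case ∈-map⁻ toList u∈ of λ { (v , _ , refl) → Vec.length-toList v }

  bitStrings-unique : ∀ n → Unique (bitStrings n)
  bitStrings-unique n = Unique.map⁺ toList-injective (vectors-unique bits-unique n)
    where
    toList-injective : ∀ {u v : Vec Bool n} → toList u ≡ toList v → u ≡ v
    toList-injective {u} {v} eq = trans (sym (Vec.cast-is-id refl u)) (Vec.toList-injective refl u v eq)

  length-bitStrings : ∀ n → length (bitStrings n) ≡ 2 ^ n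
  length-bitStrings n = trans (length-map toList (vectors bits n)) (length-vectors bits n)

  signs : List Sign
  signs = minus ∷ plus ∷ []

  ∈-signs : ∀ s → s ∈ signs
  ∈-signs minus = here refl
  ∈-signs plus = there (here refl)

  _≟ˢ_ : DecidableEquality Sign
  minus ≟ˢ minus = yes refl
  plus ≟ˢ plus = yes refl
  minus ≟ˢ plus = no λ ()
  plus ≟ˢ minus = no λ ()

module Pigeonhole {X C : Set} (_≟_ : DecidableEquality C) (class : X → C) where

  count : C → List X → ℕ
  count c xs = length (filter (λ x → class x ≟ c) xs)

  count-∷-≤ : ∀ c x xs → count c xs ≤ count c (x ∷ xs)
  count-∷-≤ c x xs with class x ≟ c
  ... | yes _ = n≤1+n _
  ... | no _ = ≤-refl

  count-∷-class : ∀ x xs → count (class x) (x ∷ xs) ≡ suc (count (class x) xs)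
  count-∷-class x xs = cong length (filter-accept (λ y → class y ≟ class x) refl)

  total : List C → List X → ℕ
  total [] xs = 0
  total (c ∷ cs) xs = count c xs + total cs xs

  total-∷-≤ : ∀ cs x xs → total cs xs ≤ total cs (x ∷ xs)
  total-∷-≤ [] x xs = z≤n
  total-∷-≤ (c ∷ cs) x xs = +-mono-≤ (count-∷-≤ c x xs) (total-∷-≤ cs x xs)

  total-∷-< : ∀ cs x xs → class x ∈ cs → total cs xs < total cs (x ∷ xs)
  total-∷-< (c ∷ cs) x xs (here refl) =
    +-mono-≤ (≤-reflexive (sym (count-∷-class x xs))) (total-∷-≤ cs x xs)
  total-∷-< (c ∷ cs) x xs (there x∈cs) =
    subst (_≤ total (c ∷ cs) (x ∷ xs)) (+-suc (count c xs) (total cs xs))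
      (+-mono-≤ (count-∷-≤ c x xs) (total-∷-< cs x xs x∈cs))

  length≤total : ∀ cs xs → (∀ {x} → x ∈ xs → class x ∈ cs) → length xs ≤ total cs xs
  length≤total cs [] _ = z≤n
  length≤total cs (x ∷ xs) covered =
    ≤-trans (s≤s (length≤total cs xs (covered ∘ there))) (total-∷-< cs x xs (covered (here refl)))

  total≤max : ∀ c₀ cs xs → ∃ λ c → c ∈ c₀ ∷ cs × total (c₀ ∷ cs) xs ≤ count c xs * length (c₀ ∷ cs)
  total≤max c₀ [] xs = c₀ , here refl , ≤-reflexive (trans (+-identityʳ _) (sym (*-identityʳ _)))
  total≤max c₀ (c₁ ∷ cs) xs with total≤max c₁ cs xs
  ... | c , c∈ , rest≤ with count c₀ xs ≤? count c xs
  ...   | yes c₀≤c = c , there c∈ ,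
    ≤-trans (+-mono-≤ c₀≤c rest≤) (≤-reflexive (sym (*-suc (count c xs) (length (c₁ ∷ cs)))))
  ...   | no c₀≰c = c₀ , here refl ,
    ≤-trans (+-monoʳ-≤ (count c₀ xs) (≤-trans rest≤ (*-monoˡ-≤ _ (<⇒≤ (≰⇒> c₀≰c)))))
            (≤-reflexive (sym (*-suc (count c₀ xs) (length (c₁ ∷ cs)))))

  pigeonhole : ∀ xs cs → (∀ {x} → x ∈ xs → class x ∈ cs) → 1 ≤ length xs →
    ∃ λ c → c ∈ cs × length xs ≤ count c xs * length cs
  pigeonhole (x ∷ xs) [] covered _ with () ← covered (here refl)
  pigeonhole xs (c₀ ∷ cs) covered _ with total≤max c₀ cs xs
  ... | c , c∈ , total≤ = c , c∈ , ≤-trans (length≤total (c₀ ∷ cs) xs covered) total≤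

module Induced where
  open Prefix

  pair-all : ∀ {v w} (P : List Bool → Set) → P v → P w → ∀ {x} → x ∈ v ∷ w ∷ [] → P x
  pair-all P pv pw = All.lookup (pv ∷ pw ∷ [])

  δ-unique : ∀ {v w z z′} → IsDelta (v ∷ w ∷ []) z → IsDelta (v ∷ w ∷ []) z′ → z ≡ z′
  δ-unique (z-anc , z-max) (z′-anc , z′-max) =
    anc-antisym (anc-connex (z-anc (here refl)) (z′-anc (here refl)) (z′-max _ z-anc)) (z-max _ z′-anc)

  δ-self : ∀ v → IsDelta (v ∷ v ∷ []) v
  δ-self v = pair-all (Anc v) (anc-refl v) (anc-refl v) , λ _ anc → anc-length (anc (here refl))

  δ-sym : ∀ {v w z} → IsDelta (w ∷ v ∷ []) z → IsDelta (v ∷ w ∷ []) z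
  δ-sym {z = z} (z-anc , z-max) =
    pair-all (Anc z) (z-anc (there (here refl))) (z-anc (here refl)) ,
    λ r anc → z-max r (pair-all (Anc r) (anc (there (here refl))) (anc (here refl)))

  δ-children : ∀ {u v w} → Anc (u ∷ʳ false) v → Anc (u ∷ʳ true) w → IsDelta (v ∷ w ∷ []) u
  δ-children {u} {v} {w} p q =
    pair-all (Anc u) (anc-trans (anc-∷ʳ u false) p) (anc-trans (anc-∷ʳ u true) q) , maximal
    where
    maximal : ∀ r → (∀ {x} → x ∈ v ∷ w ∷ [] → Anc r x) → length r ≤ length u
    maximal r anc with length r ≤? length u
    ... | yes r≤u = r≤u
    ... | no r≰u = ⊥-elim (children-disjoint (anc-connex p (anc (here refl)) (below false))
                                             (anc-connex q (anc (there (here refl))) (below true)))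
      where
      below : ∀ b → length (u ∷ʳ b) ≤ length r
      below b = subst (_≤ length r) (sym (length-∷ʳ u b)) (≰⇒> r≰u)

  induced-mono : ∀ {X Y z} → (∀ {x} → x ∈ X → x ∈ Y) → InInd X z → InInd Y z
  induced-mono X⊆Y (v , w , v∈ , w∈ , δ) = v , w , X⊆Y v∈ , X⊆Y w∈ , δ

  adjacent-sym : ∀ {X x y} → AdjInd X x y → AdjInd X y x
  adjacent-sym (x∈ , y∈ , x≢y , related , nothing-between) =
    y∈ , x∈ , x≢y ∘ sym , swap related , λ z z∈ z≢y z≢x → nothing-between z z∈ z≢x z≢y ∘ swap

module Copies (m d : ℕ) (lab : Labelling m d) where
  open Prefix
  open Induced

  Label : Set
  Label = Vec Sign d

  -- BTCopy j σ u: a copy of BT_j in BT_m rooted at u, whose leaves are leaves of BT_m and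
  -- whose vertices at depth i (in the copy) all carry the label σ_i.
  data BTCopy : (j : ℕ) → Vec Label j → List Bool → Set where
    leaf : ∀ {u} → length u ≡ m → BTCopy 0 []ᵥ u
    node : ∀ {j σ u v w ℓ} (u<m : length u < m) → lab u u<m ≡ ℓ →
           BTCopy j σ v → BTCopy j σ w → Anc (u ∷ʳ false) v → Anc (u ∷ʳ true) w →
           BTCopy (suc j) (ℓ ∷ᵥ σ) u

  variable
    j : ℕ
    σ : Vec Label j
    u : List Bool

  leaves : BTCopy j σ u → List (List Bool)
  leaves {u = u} (leaf _) = [ u ]
  leaves (node _ _ L R _ _) = leaves L ++ leaves R

  -- The vertex reached from the root of the copy along the path a (junk if length a > j).
  vertexAt : BTCopy j σ u → List Bool → List Bool
  vertexAt {u = u} T [] = u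
  vertexAt {u = u} (leaf _) (_ ∷ _) = u
  vertexAt (node _ _ L R _ _) (false ∷ a) = vertexAt L a
  vertexAt (node _ _ L R _ _) (true ∷ a) = vertexAt R a

  anc-leaves : (T : BTCopy j σ u) → ∀ {x} → x ∈ leaves T → Anc u x
  anc-leaves (leaf _) (here refl) = anc-refl _
  anc-leaves (node _ _ L R p q) x∈ with ∈-++⁻ (leaves L) x∈
  ... | inj₁ x∈L = anc-trans (anc-trans (anc-∷ʳ _ _) p) (anc-leaves L x∈L)
  ... | inj₂ x∈R = anc-trans (anc-trans (anc-∷ʳ _ _) q) (anc-leaves R x∈R)

  leaves-length : (T : BTCopy j σ u) → All (λ x → length x ≡ m) (leaves T)
  leaves-length (leaf u≡m) = u≡m ∷ []
  leaves-length (node _ _ L R _ _) = All.++⁺ (leaves-length L) (leaves-length R)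

  length-leaves : (T : BTCopy j σ u) → length (leaves T) ≡ 2 ^ j
  length-leaves (leaf _) = refl
  length-leaves {suc j} (node _ _ L R _ _) = begin
    length (leaves L ++ leaves R)       ≡⟨ length-++ (leaves L) ⟩
    length (leaves L) + length (leaves R) ≡⟨ cong₂ _+_ (length-leaves L) (length-leaves R) ⟩
    2 ^ j + 2 ^ j                       ≡⟨ cong (2 ^ j +_) (sym (+-identityʳ (2 ^ j))) ⟩
    2 ^ suc j                           ∎
    where open ≡-Reasoning

  leaves-unique : (T : BTCopy j σ u) → Unique (leaves T)
  leaves-unique (leaf _) = [] AllPairs.∷ AllPairs.[]
  leaves-unique (node _ _ L R p q) = Unique.++⁺ (leaves-unique L) (leaves-unique R) disjoint
    where
    disjoint : ∀ {x} → ¬ (x ∈ leaves L × x ∈ leaves R)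
    disjoint (x∈L , x∈R) = children-disjoint (anc-trans p (anc-leaves L x∈L)) (anc-trans q (anc-leaves R x∈R))

  some-leaf : (T : BTCopy j σ u) → ∃ λ x → x ∈ leaves T
  some-leaf {u = u} (leaf _) = u , here refl
  some-leaf (node _ _ L R _ _) with some-leaf L
  ... | x , x∈ = x , ∈-++⁺ˡ x∈

  anc-vertexAt : (T : BTCopy j σ u) → ∀ a → Anc u (vertexAt T a)
  anc-vertexAt T [] = anc-refl _
  anc-vertexAt (leaf _) (_ ∷ _) = anc-refl _
  anc-vertexAt (node _ _ L R p q) (false ∷ a) = anc-trans (anc-trans (anc-∷ʳ _ _) p) (anc-vertexAt L a)
  anc-vertexAt (node _ _ L R p q) (true ∷ a) = anc-trans (anc-trans (anc-∷ʳ _ _) q) (anc-vertexAt R a)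

  vertexAt-∷ : (T : BTCopy j σ u) → ∀ c a → length (c ∷ a) ≤ j → Anc (u ∷ʳ c) (vertexAt T (c ∷ a))
  vertexAt-∷ (node _ _ L R p q) false a _ = anc-trans p (anc-vertexAt L a)
  vertexAt-∷ (node _ _ L R p q) true a _ = anc-trans q (anc-vertexAt R a)

  vertexAt-mono : (T : BTCopy j σ u) → ∀ a b → Anc a b → Anc (vertexAt T a) (vertexAt T b)
  vertexAt-mono T [] b _ = anc-vertexAt T b
  vertexAt-mono (leaf _) (_ ∷ _) [] (_ , ())
  vertexAt-mono (leaf _) (_ ∷ _) (_ ∷ _) _ = anc-refl _
  vertexAt-mono (node _ _ L R _ _) (_ ∷ _) [] (_ , ())
  vertexAt-mono (node _ _ L R _ _) (x ∷ a) (y ∷ b) a≤b with ∷-anc⁻ a≤b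
  vertexAt-mono (node _ _ L R _ _) (false ∷ a) (false ∷ b) _ | refl , a≤b = vertexAt-mono L a b a≤b
  vertexAt-mono (node _ _ L R _ _) (true ∷ a) (true ∷ b) _ | refl , a≤b = vertexAt-mono R a b a≤b

  vertexAt-reflects : (T : BTCopy j σ u) → ∀ a b → length a ≤ j → length b ≤ j →
    Anc (vertexAt T a) (vertexAt T b) → Anc a b
  vertexAt-reflects T [] b _ _ _ = []-anc b
  vertexAt-reflects T (c ∷ a) [] a≤j _ anc = ⊥-elim (∷ʳ-¬anc (anc-trans (vertexAt-∷ T c a a≤j) anc))
  vertexAt-reflects (node _ _ L R _ _) (false ∷ a) (false ∷ b) (s≤s a≤j) (s≤s b≤j) anc =
    ∷-anc⁺ (vertexAt-reflects L a b a≤j b≤j anc)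
  vertexAt-reflects (node _ _ L R _ _) (true ∷ a) (true ∷ b) (s≤s a≤j) (s≤s b≤j) anc =
    ∷-anc⁺ (vertexAt-reflects R a b a≤j b≤j anc)
  vertexAt-reflects T@(node _ _ _ _ _ _) (false ∷ a) (true ∷ b) a≤j b≤j anc =
    ⊥-elim (children-disjoint (anc-trans (vertexAt-∷ T false a a≤j) anc) (vertexAt-∷ T true b b≤j))
  vertexAt-reflects T@(node _ _ _ _ _ _) (true ∷ a) (false ∷ b) a≤j b≤j anc =
    ⊥-elim (children-disjoint (vertexAt-∷ T false b b≤j) (anc-trans (vertexAt-∷ T true a a≤j) anc))

  vertexAt-injective : (T : BTCopy j σ u) → ∀ a b → length a ≤ j → length b ≤ j →
    vertexAt T a ≡ vertexAt T b → a ≡ b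
  vertexAt-injective T a b a≤j b≤j eq =
    anc-antisym (vertexAt-reflects T a b a≤j b≤j (subst (Anc _) eq (anc-refl _)))
                (anc-length (vertexAt-reflects T b a b≤j a≤j (subst (Anc _) (sym eq) (anc-refl _))))

  δ-leaves : (T : BTCopy j σ u) → ∀ {v w} → v ∈ leaves T → w ∈ leaves T →
    ∃ λ a → length a ≤ j × IsDelta (v ∷ w ∷ []) (vertexAt T a)
  δ-leaves (leaf _) (here refl) (here refl) = [] , z≤n , δ-self _
  δ-leaves (node _ _ L R p q) v∈ w∈ with ∈-++⁻ (leaves L) v∈ | ∈-++⁻ (leaves L) w∈
  ... | inj₁ v∈L | inj₁ w∈L with δ-leaves L v∈L w∈L
  ...   | a , a≤j , δ = false ∷ a , s≤s a≤j , δ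
  δ-leaves (node _ _ L R p q) v∈ w∈ | inj₂ v∈R | inj₂ w∈R with δ-leaves R v∈R w∈R
  ...   | a , a≤j , δ = true ∷ a , s≤s a≤j , δ
  δ-leaves (node _ _ L R p q) v∈ w∈ | inj₁ v∈L | inj₂ w∈R =
    [] , z≤n , δ-children (anc-trans p (anc-leaves L v∈L)) (anc-trans q (anc-leaves R w∈R))
  δ-leaves (node _ _ L R p q) v∈ w∈ | inj₂ v∈R | inj₁ w∈L =
    [] , z≤n , δ-sym (δ-children (anc-trans p (anc-leaves L w∈L)) (anc-trans q (anc-leaves R v∈R)))

  vertexAt-induced : (T : BTCopy j σ u) → ∀ a → length a ≤ j → InInd (leaves T) (vertexAt T a)
  vertexAt-induced {u = u} (leaf _) [] _ = u , u , here refl , here refl , δ-self u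
  vertexAt-induced (node _ _ L R p q) [] _ with some-leaf L | some-leaf R
  ... | v , v∈ | w , w∈ = v , w , ∈-++⁺ˡ v∈ , ∈-++⁺ʳ (leaves L) w∈ ,
    δ-children (anc-trans p (anc-leaves L v∈)) (anc-trans q (anc-leaves R w∈))
  vertexAt-induced (node _ _ L R _ _) (false ∷ a) (s≤s a≤j) =
    induced-mono ∈-++⁺ˡ (vertexAt-induced L a a≤j)
  vertexAt-induced (node _ _ L R _ _) (true ∷ a) (s≤s a≤j) =
    induced-mono (∈-++⁺ʳ (leaves L)) (vertexAt-induced R a a≤j)

  induced-vertexAt : (T : BTCopy j σ u) → ∀ {z} → InInd (leaves T) z →
    ∃ λ a → length a ≤ j × vertexAt T a ≡ z
  induced-vertexAt T (v , w , v∈ , w∈ , δ) with δ-leaves T v∈ w∈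
  ... | a , a≤j , δ′ = a , a≤j , δ-unique δ′ δ

  root-δ : (T : BTCopy j σ u) → IsDelta (leaves T) u
  root-δ T with vertexAt-induced T [] z≤n
  ... | v , w , v∈ , w∈ , _ , maximal = anc-leaves T , λ r anc → maximal r (pair-all (Anc r) (anc v∈) (anc w∈))

  label-vertexAt : (T : BTCopy j σ u) → ∀ a (a<j : length a < j) (a<m : length (vertexAt T a) < m) →
    lab (vertexAt T a) a<m ≡ Vec.lookup σ (fromℕ< a<j)
  label-vertexAt (node u<m lab≡ _ _ _ _) [] _ a<m = trans (cong (lab _) (<-irrelevant a<m u<m)) lab≡
  label-vertexAt (node _ _ L _ _ _) (false ∷ a) (s≤s a<j) a<m = label-vertexAt L a a<j a<m
  label-vertexAt (node _ _ _ R _ _) (true ∷ a) (s≤s a<j) a<m = label-vertexAt R a a<j a<m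

  module _ (T : BTCopy j σ u) where

    f : List Bool → List Bool
    f = vertexAt T

    child-adjacent : ∀ a c → length (a ∷ʳ c) ≤ j → AdjInd (leaves T) (f a) (f (a ∷ʳ c))
    child-adjacent a c ac≤j =
      vertexAt-induced T a a≤j , vertexAt-induced T (a ∷ʳ c) ac≤j , distinct ,
      inj₁ (vertexAt-mono T a (a ∷ʳ c) (anc-∷ʳ a c)) , nothing-between
      where
      a≤j : length a ≤ j
      a≤j = ≤-trans (anc-length (anc-∷ʳ a c)) ac≤j
      distinct : f a ≢ f (a ∷ʳ c)
      distinct eq = anc-proper c [] refl (vertexAt-injective T a (a ∷ʳ c) a≤j ac≤j eq)
      nothing-between : ∀ z → InInd (leaves T) z → z ≢ f a → z ≢ f (a ∷ʳ c) →
        ¬ ((Anc (f a) z × Anc z (f (a ∷ʳ c))) ⊎ (Anc (f (a ∷ʳ c)) z × Anc z (f a)))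
      nothing-between z z∈ z≢ z≢′ between with induced-vertexAt T z∈
      nothing-between _ _ z≢ z≢′ (inj₁ (p , q)) | e , e≤j , refl
        with between-child (vertexAt-reflects T a e a≤j e≤j p) (vertexAt-reflects T e (a ∷ʳ c) e≤j ac≤j q)
      ... | inj₁ refl = z≢ refl
      ... | inj₂ refl = z≢′ refl
      nothing-between _ _ _ _ (inj₂ (p , q)) | e , e≤j , refl =
        ∷ʳ-¬anc (vertexAt-reflects T (a ∷ʳ c) a ac≤j a≤j (anc-trans p q))

    adjacent-child : ∀ a b → length a ≤ j → length b ≤ j → AdjInd (leaves T) (f a) (f b) →
      Anc (f a) (f b) → ∃ λ c → b ≡ a ++ [ c ]
    adjacent-child a b a≤j b≤j (_ , _ , distinct , _ , nothing-between) anc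
      with vertexAt-reflects T a b a≤j b≤j anc
    ... | [] , eq = ⊥-elim (distinct (cong f (trans (sym (++-identityʳ a)) eq)))
    ... | c ∷ [] , eq = c , sym eq
    ... | c ∷ c′ ∷ r , eq =
      ⊥-elim (nothing-between (f e) (vertexAt-induced T e e≤j) e≢a e≢b
               (inj₁ (vertexAt-mono T a e (anc-∷ʳ a c) , vertexAt-mono T e b e≤b)))
      where
      e = a ∷ʳ c
      e≤b : Anc e b
      e≤b = c′ ∷ r , trans (++-assoc a [ c ] (c′ ∷ r)) eq
      e≤j : length e ≤ j
      e≤j = ≤-trans (anc-length e≤b) b≤j
      e≢a : f e ≢ f a
      e≢a eq′ = anc-proper c [] refl (sym (vertexAt-injective T e a e≤j a≤j eq′))
      e≢b : f e ≢ f b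
      e≢b eq′ = anc-proper c′ r (proj₂ e≤b) (vertexAt-injective T e b e≤j b≤j eq′)

    leaves-perfect : Perfect m d lab (leaves T)
    leaves-perfect = j , f ∘ proj₁ , (induced , injective , surjective , adjacency , root-δ T) , labels
      where
      induced : ∀ a → InInd (leaves T) (f (proj₁ a))
      induced (a , a≤j) = vertexAt-induced T a a≤j
      injective : ∀ a b → f (proj₁ a) ≡ f (proj₁ b) → proj₁ a ≡ proj₁ b
      injective (a , a≤j) (b , b≤j) = vertexAt-injective T a b a≤j b≤j
      surjective : ∀ y → InInd (leaves T) y → ∃ λ a → f (proj₁ a) ≡ y
      surjective y y∈ with induced-vertexAt T y∈
      ... | a , a≤j , eq = (a , a≤j) , eq
      adjacency : ∀ a b → AdjBT (proj₁ a) (proj₁ b) ⇔ AdjInd (leaves T) (f (proj₁ a)) (f (proj₁ b))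
      adjacency (a , a≤j) (b , b≤j) = mk⇔ to from
        where
        to : AdjBT a b → AdjInd (leaves T) (f a) (f b)
        to (inj₁ (c , refl)) = child-adjacent a c b≤j
        to (inj₂ (c , refl)) = adjacent-sym (child-adjacent b c a≤j)
        from : AdjInd (leaves T) (f a) (f b) → AdjBT a b
        from adj@(_ , _ , _ , inj₁ anc , _) = inj₁ (adjacent-child a b a≤j b≤j adj anc)
        from adj@(_ , _ , _ , inj₂ anc , _) = inj₂ (adjacent-child b a b≤j a≤j (adjacent-sym adj) anc)
      labels : ∀ a b → length (proj₁ a) ≡ length (proj₁ b) → length (proj₁ a) < j →
        (pa : length (f (proj₁ a)) < m) (pb : length (f (proj₁ b)) < m) →
        lab (f (proj₁ a)) pa ≡ lab (f (proj₁ b)) pb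
      labels (a , _) (b , _) eq a<j pa pb = begin
        lab (f a) pa                               ≡⟨ label-vertexAt T a a<j pa ⟩
        Vec.lookup σ (fromℕ< a<j)                  ≡⟨ cong (Vec.lookup σ) (fromℕ<-cong _ _ eq a<j b<j) ⟩
        Vec.lookup σ (fromℕ< b<j)                  ≡⟨ sym (label-vertexAt T b b<j pb) ⟩
        lab (f b) pb                               ∎
        where
        open ≡-Reasoning
        b<j = subst (_< j) eq a<j

module BranchingVertices {D : ℕ} (R : List (List Bool)) (R-unique : Unique R)
                         (R-depth : All (λ r → length r ≡ D) R) where
  open Prefix

  below : List Bool → List (List Bool)
  below w = filter (anc? w) R

  Branching : List Bool → Set
  Branching w = 0 < length (below (w ∷ʳ false)) × 0 < length (below (w ∷ʳ true))

  branching? : ∀ w → Dec (Branching w)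
  branching? w = 0 <? length (below (w ∷ʳ false)) ×-dec 0 <? length (below (w ∷ʳ true))

  subtree : List Bool → ℕ → List (List Bool)
  subtree w zero = []
  subtree w (suc h) = w ∷ subtree (w ∷ʳ false) h ++ subtree (w ∷ʳ true) h

  branchings : List Bool → ℕ → List (List Bool)
  branchings w h = filter branching? (subtree w h)

  subtree-anc : ∀ w h {x} → x ∈ subtree w h → Anc w x × length x < length w + h
  subtree-anc w (suc h) (here refl) = anc-refl w , m<m+n (length w) (s≤s z≤n)
  subtree-anc w (suc h) (there x∈) =
    [ from-child false ∘ subtree-anc (w ∷ʳ false) h , from-child true ∘ subtree-anc (w ∷ʳ true) h ]′
      (∈-++⁻ (subtree (w ∷ʳ false) h) x∈)
    where
    from-child : ∀ b {x} → Anc (w ∷ʳ b) x × length x < length (w ∷ʳ b) + h →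
                 Anc w x × length x < length w + suc h
    from-child b {x} (anc , x<) =
      anc-trans (anc-∷ʳ w b) anc , subst (length x <_) (length-∷ʳ-+ w b h) x<

  subtree-unique : ∀ w h → Unique (subtree w h)
  subtree-unique w zero = AllPairs.[]
  subtree-unique w (suc h) =
    All.tabulate w∉ AllPairs.∷ Unique.++⁺ (subtree-unique _ h) (subtree-unique _ h) disjoint
    where
    w∉ : ∀ {x} → x ∈ subtree (w ∷ʳ false) h ++ subtree (w ∷ʳ true) h → w ≢ x
    w∉ x∈ refl = [ ∷ʳ-¬anc ∘ proj₁ ∘ subtree-anc _ h , ∷ʳ-¬anc ∘ proj₁ ∘ subtree-anc _ h ]′
                   (∈-++⁻ (subtree (w ∷ʳ false) h) x∈)
    disjoint : ∀ {x} → ¬ (x ∈ subtree (w ∷ʳ false) h × x ∈ subtree (w ∷ʳ true) h)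
    disjoint (x∈₀ , x∈₁) = children-disjoint (proj₁ (subtree-anc _ h x∈₀)) (proj₁ (subtree-anc _ h x∈₁))

  length-below-split : ∀ w rs → All (λ r → length w < length r) rs →
    length (filter (anc? w) rs) ≡ length (filter (anc? (w ∷ʳ false)) rs) + length (filter (anc? (w ∷ʳ true)) rs)
  length-below-split w [] [] = refl
  length-below-split w (r ∷ rs) (w<r ∷ w<rs)
    with anc? w r | anc? (w ∷ʳ false) r | anc? (w ∷ʳ true) r | length-below-split w rs w<rs
  ... | _      | yes p  | yes q  | _  = ⊥-elim (children-disjoint p q)
  ... | yes _  | yes _  | no _   | ih = cong suc ih
  ... | yes _  | no _   | yes _  | ih = trans (cong suc ih) (sym (+-suc _ _))
  ... | yes a  | no ¬p  | no ¬q  | _  = ⊥-elim ([ ¬p , ¬q ]′ (anc-child w<r a))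
  ... | no ¬a  | yes p  | no _   | _  = ⊥-elim (¬a (anc-trans (anc-∷ʳ w false) p))
  ... | no ¬a  | no _   | yes q  | _  = ⊥-elim (¬a (anc-trans (anc-∷ʳ w true) q))
  ... | no _   | no _   | no _   | ih = ih

  length-below-leaf : ∀ w → length w ≡ D → length (below w) ≤ 1
  length-below-leaf w w≡D = at-most-one (Unique.filter⁺ (anc? w) R-unique) (All.tabulate equals-w)
    where
    equals-w : ∀ {r} → r ∈ below w → r ≡ w
    equals-w r∈ with ∈-filter⁻ (anc? w) r∈
    ... | r∈R , anc = sym (anc-antisym anc (≤-reflexive (trans (All.lookup R-depth r∈R) (sym w≡D))))
    at-most-one : ∀ {xs} → Unique xs → All (_≡ w) xs → length xs ≤ 1
    at-most-one {[]} _ _ = z≤n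
    at-most-one {_ ∷ []} _ _ = s≤s z≤n
    at-most-one {_ ∷ _ ∷ _} ((x≢y ∷ _) AllPairs.∷ _) (refl ∷ refl ∷ _) = ⊥-elim (x≢y refl)

  length-below≤branchings : ∀ w h → length w + h ≡ D → length (below w) ≤ 1 + length (branchings w h)
  length-below≤branchings w zero w≡D = length-below-leaf w (trans (sym (+-identityʳ _)) w≡D)
  length-below≤branchings w (suc h) w+h≡D = begin
    length (below w) ≡⟨ length-below-split w R deeper ⟩
    n₀ + n₁          ≤⟨ split-bound ⟩
    suc (length (branchings w (suc h))) ∎
    where
    open ≤-Reasoning
    n₀ = length (below (w ∷ʳ false))
    n₁ = length (below (w ∷ʳ true))
    b₀ = length (branchings (w ∷ʳ false) h)
    b₁ = length (branchings (w ∷ʳ true) h)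
    deeper : All (λ r → length w < length r) R
    deeper = All.map (λ r≡D → subst (length w <_) (trans w+h≡D (sym r≡D)) (m<m+n (length w) (s≤s z≤n))) R-depth
    ih : ∀ b → length (below (w ∷ʳ b)) ≤ suc (length (branchings (w ∷ʳ b) h))
    ih b = length-below≤branchings (w ∷ʳ b) h (trans (length-∷ʳ-+ w b h) w+h≡D)
    rest = filter branching? (subtree (w ∷ʳ false) h ++ subtree (w ∷ʳ true) h)
    branchings-children : length rest ≡ b₀ + b₁
    branchings-children =
      trans (cong length (filter-++ branching? (subtree (w ∷ʳ false) h) _)) (length-++ (branchings (w ∷ʳ false) h))
    unbranched : ∀ {x y a b} → x ≤ suc a → y ≤ suc b → ¬ (0 < x × 0 < y) → x + y ≤ suc (a + b)
    unbranched {zero} {_} {a} {b} _ y≤ _ = ≤-trans y≤ (s≤s (m≤n+m b a))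
    unbranched {suc x} {zero} {a} {b} x≤ _ _ =
      ≤-trans (≤-reflexive (+-identityʳ _)) (≤-trans x≤ (s≤s (m≤m+n a b)))
    unbranched {suc x} {suc y} _ _ ¬both = ⊥-elim (¬both (s≤s z≤n , s≤s z≤n))
    split-bound : n₀ + n₁ ≤ suc (length (branchings w (suc h)))
    split-bound with branching? w
    ... | yes branching = ≤-trans (+-mono-≤ (ih false) (ih true)) (≤-reflexive (cong suc (begin-equality
      b₀ + suc b₁ ≡⟨ +-suc b₀ b₁ ⟩
      suc (b₀ + b₁) ≡⟨ cong suc (sym branchings-children) ⟩
      suc (length rest) ≡⟨ cong length (sym (filter-accept branching? branching)) ⟩
      length (branchings w (suc h)) ∎)))
    ... | no ¬branching = ≤-trans (unbranched (ih false) (ih true) ¬branching) (≤-reflexive (cong suc (begin-equality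
      b₀ + b₁ ≡⟨ sym branchings-children ⟩
      length rest ≡⟨ cong length (sym (filter-reject branching? ¬branching)) ⟩
      length (branchings w (suc h)) ∎)))

  branchings-unique : ∀ w h → Unique (branchings w h)
  branchings-unique w h = Unique.filter⁺ branching? (subtree-unique w h)

  ∈-branchings : ∀ {x} → x ∈ branchings [] D → Branching x × length x < D
  ∈-branchings x∈ with ∈-filter⁻ branching? x∈
  ... | x∈subtree , branching = branching , proj₂ (subtree-anc [] D x∈subtree)

  below-nonempty : ∀ w → 0 < length (below w) → ∃ λ r → r ∈ R × Anc w r
  below-nonempty w pos with below w | (λ {r} → ∈-filter⁻ (anc? w) {r} {R})
  ... | r ∷ _ | ∈below⁻ = r , ∈below⁻ (here refl)

  length-below-[] : length (below []) ≡ length R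
  length-below-[] = cong length (filter-all (anc? []) {R} (All.tabulate λ {r} _ → []-anc r))

module Construction (m d : ℕ) (lab : Labelling m d) (1≤m : 1 ≤ m) where
  open Prefix
  open Enumeration
  open Copies m d lab

  K : ℕ
  K = 2 ^ (d + 1) * m

  2≤K : 2 ≤ K
  2≤K = *-mono-≤ {2} {2 ^ (d + 1)} {1} {m} 2≤2^[d+1] 1≤m
    where
    2≤2^[d+1] : 2 ≤ 2 ^ (d + 1)
    2≤2^[d+1] = subst (2 ≤_) (cong (2 ^_) (+-comm 1 d)) (*-monoʳ-≤ 2 (m^n>0 2 d))

  instance
    K-nonZero : NonZero K
    K-nonZero = >-nonZero (≤-trans (s≤s z≤n) 2≤K)

  record Stage (j : ℕ) : Set where
    field
      depth : ℕ
      labels : Vec Label j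
      roots : List (List Bool)
      depth≤m : depth ≤ m
      roots-unique : Unique roots
      roots-depth : All (λ r → length r ≡ depth) roots
      copies : ∀ {r} → r ∈ roots → BTCopy j labels r
      many-roots : 2 ^ m ≤ length roots * K ^ j

  initial : Stage 0
  initial = record
    { depth = m
    ; labels = []ᵥ
    ; roots = bitStrings m
    ; depth≤m = ≤-refl
    ; roots-unique = bitStrings-unique m
    ; roots-depth = bitStrings-length m
    ; copies = leaf ∘ All.lookup (bitStrings-length m)
    ; many-roots = ≤-reflexive (trans (sym (length-bitStrings m)) (sym (*-identityʳ _)))
    }

  label : List Bool → Label
  label x with length x <? m
  ... | yes x<m = lab x x<m
  ... | no _ = replicate d minus

  label-lab : ∀ x (x<m : length x < m) → label x ≡ lab x x<m
  label-lab x x<m with length x <? m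
  ... | yes x<m′ = cong (lab x) (<-irrelevant x<m′ x<m)
  ... | no x≮m = ⊥-elim (x≮m x<m)

  class : List Bool → ℕ × Label
  class x = length x , label x

  _≟ᶜ_ : DecidableEquality (ℕ × Label)
  _≟ᶜ_ = Product.≡-dec _≟_ (Vec.≡-dec _≟ˢ_)

  classes : ℕ → List (ℕ × Label)
  classes D = cartesianProduct (upTo D) (vectors signs d)

  length-classes : ∀ D → length (classes D) ≡ D * 2 ^ d
  length-classes D = trans (length-cartesianProductWith _,_ (upTo D) (vectors signs d))
                           (cong₂ _*_ (length-upTo D) (length-vectors signs d))

  r≤c*K : ∀ {r s c D} → 2 ≤ r → r ≤ suc s → s ≤ c * (D * 2 ^ d) → D ≤ m → r ≤ c * K
  r≤c*K {r} {s} {c} {D} 2≤r r≤1+s s≤ D≤m = begin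
    r                           ≤⟨ ≤-trans r≤1+s (+-monoˡ-≤ s 1≤s) ⟩
    s + s                       ≤⟨ +-mono-≤ s≤′ s≤′ ⟩
    c * (m * 2 ^ d) + c * (m * 2 ^ d) ≡⟨ double c m (2 ^ d) ⟩
    c * (2 * 2 ^ d * m)         ≡⟨ cong (λ e → c * (2 ^ e * m)) (+-comm 1 d) ⟩
    c * K                       ∎
    where
    open ≤-Reasoning
    1≤s : 1 ≤ s
    1≤s = ≤-pred (≤-trans 2≤r r≤1+s)
    s≤′ : s ≤ c * (m * 2 ^ d)
    s≤′ = ≤-trans s≤ (*-monoʳ-≤ c (*-monoˡ-≤ (2 ^ d) D≤m))
    double : ∀ c m p → c * (m * p) + c * (m * p) ≡ c * (2 * p * m)
    double = solve-∀

  module Next {j} (S : Stage j) (K≤roots : K ≤ length (Stage.roots S)) where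
    open Stage S
    open BranchingVertices roots roots-unique roots-depth
    open Pigeonhole _≟ᶜ_ class

    candidates : List (List Bool)
    candidates = branchings [] depth

    roots≤candidates : length roots ≤ suc (length candidates)
    roots≤candidates = subst (_≤ suc (length candidates)) length-below-[] (length-below≤branchings [] depth refl)

    covered : ∀ {x} → x ∈ candidates → class x ∈ classes depth
    covered x∈ = ∈-cartesianProduct⁺ (∈-upTo⁺ (proj₂ (∈-branchings x∈))) (∈-vectors ∈-signs (label _))

    popular : ∃ λ c → c ∈ classes depth × length candidates ≤ count c candidates * length (classes depth)
    popular = pigeonhole candidates (classes depth) covered
      (≤-pred (≤-trans (≤-trans 2≤K K≤roots) roots≤candidates))

    e : ℕ
    e = proj₁ (proj₁ popular)

    ℓ : Label
    ℓ = proj₂ (proj₁ popular)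

    roots′ : List (List Bool)
    roots′ = filter (λ x → class x ≟ᶜ (e , ℓ)) candidates

    ∈-roots′ : ∀ {x} → x ∈ roots′ → x ∈ candidates × class x ≡ (e , ℓ)
    ∈-roots′ = ∈-filter⁻ (λ x → class x ≟ᶜ (e , ℓ))

    e<depth : e < depth
    e<depth = ∈-upTo⁻ (proj₁ (∈-cartesianProduct⁻ (upTo depth) (vectors signs d) (proj₁ (proj₂ popular))))

    copy : ∀ {x} → x ∈ roots′ → BTCopy (suc j) (ℓ ∷ᵥ labels) x
    copy {x} x∈ with ∈-roots′ x∈
    ... | x∈candidates , class≡ with ∈-branchings x∈candidates
    ...   | (below₀ , below₁) , x<depth with below-nonempty _ below₀ | below-nonempty _ below₁
    ...     | r₀ , r₀∈ , anc₀ | r₁ , r₁∈ , anc₁ =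
      node x<m (trans (sym (label-lab x x<m)) (cong proj₂ class≡)) (copies r₀∈) (copies r₁∈) anc₀ anc₁
      where
      x<m : length x < m
      x<m = <-≤-trans x<depth depth≤m

    many-roots′ : 2 ^ m ≤ length roots′ * K ^ suc j
    many-roots′ = begin
      2 ^ m                         ≤⟨ many-roots ⟩
      length roots * K ^ j          ≤⟨ *-monoˡ-≤ (K ^ j) roots≤roots′*K ⟩
      length roots′ * K * K ^ j     ≡⟨ *-assoc (length roots′) K (K ^ j) ⟩
      length roots′ * K ^ suc j     ∎
      where
      open ≤-Reasoning
      roots≤roots′*K : length roots ≤ length roots′ * K
      roots≤roots′*K = r≤c*K {c = length roots′} (≤-trans 2≤K K≤roots) roots≤candidates
        (subst (length candidates ≤_) (cong (count (e , ℓ) candidates *_) (length-classes depth))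
          (proj₂ (proj₂ popular)))
        depth≤m

    stage : Stage (suc j)
    stage = record
      { depth = e
      ; labels = ℓ ∷ᵥ labels
      ; roots = roots′
      ; depth≤m = <⇒≤ (<-≤-trans e<depth depth≤m)
      ; roots-unique = Unique.filter⁺ (λ x → class x ≟ᶜ (e , ℓ)) (branchings-unique [] depth)
      ; roots-depth = All.tabulate (cong proj₁ ∘ proj₂ ∘ ∈-roots′)
      ; copies = copy
      ; many-roots = many-roots′
      }

  stage : ∀ j → K ^ j ≤ 2 ^ m → Stage j
  stage zero _ = initial
  stage (suc j) K^[1+j]≤ = Next.stage S K≤roots
    where
    S = stage j (≤-trans (m≤n*m (K ^ j) K) K^[1+j]≤)
    K≤roots : K ≤ length (Stage.roots S)
    K≤roots = *-cancelʳ-≤ K _ (K ^ j) {{m^n≢0 K j}} (≤-trans K^[1+j]≤ (Stage.many-roots S))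

  copy-of-BT : ∀ t → K ^ t ≤ 2 ^ m → ∃ λ σ → ∃ λ u → BTCopy t σ u
  copy-of-BT t K^t≤ with stage t K^t≤
  ... | S with Stage.roots S | Stage.copies S | Stage.many-roots S
  ...   | [] | _ | many = ⊥-elim (<⇒≱ (m^n>0 2 m) many)
  ...   | r ∷ _ | copies | _ = Stage.labels S , r , copies (here refl)

lemma5 : (m t d : ℕ) → 1 ≤ m → 1 ≤ t → 1 ≤ d →
    (2 ^ (d + 1) * m) ^ t ≤ 2 ^ m →
    (lab : Labelling m d) →
    ∃ λ (S : List (List Bool)) →
      All (λ x → length x ≡ m) S × Unique S × length S ≡ 2 ^ t ×
      Perfect m d lab S
lemma5 m t d 1≤m _ _ K^t≤2^m lab with Construction.copy-of-BT m d lab 1≤m t K^t≤2^m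
... | _ , _ , T = leaves T , leaves-length T , leaves-unique T , length-leaves T , leaves-perfect T
  where open Copies m d lab
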